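{- Let $p$ be an odd prime. The polynomial $f\in\mathbb{F}_p[x_1,\ldots,x_{p+1}]$ defined by $$f(x_1,\ldots,x_{p+1})=(x_1+x_2+\cdots+x_p)^{p-1}\,(x_1+2x_2+\cdots+p\,x_p+x_{p+1})^{p-1}$$ (coefficients read modulo $p$) contains no monomial with nonzero coefficient in which all the variables $x_1,\ldots,x_{p+1}$ have positive exponents. -}

module Defs where

-- The polynomial is the (formal) sum of its terms; repeated exponent
-- vectors are allowed and their coefficients add up (see `coeff`).

open import Data.Nat using (ℕ; zero; suc; _+_; _*_; _<ᵇ_)
import Data.Nat.Properties as ℕₚ
open import Data.Fin using (Fin; toℕ)
open import Data.Vec using (Vec; replicate; zipWith; _[_]≔_)
open import Data.Vec.Properties using (≡-dec)
open import Data.List using (List; []; _∷_; _++_; concatMap; map; filter)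
open import Data.Nat.ListAction using (sum)
open import Data.List using (allFin)
open import Data.Product using (_×_; _,_; proj₁; proj₂)
open import Data.Bool using (if_then_else_)
open import Relation.Nullary.Decidable using (⌊_⌋)

Monomial : ℕ → Set
Monomial n = Vec ℕ n

Poly : ℕ → Set
Poly n = List (ℕ × Monomial n)

one : ∀ {n} → Poly n
one {n} = (1 , replicate n 0) ∷ []

unit : ∀ {n} → Fin n → Monomial n
unit {n} i = replicate n 0 [ i ]≔ 1

_+P_ : ∀ {n} → Poly n → Poly n → Poly n
_+P_ = _++_

_*P_ : ∀ {n} → Poly n → Poly n → Poly n
P *P Q = concatMap (λ t → map (λ s → (proj₁ t * proj₁ s , zipWith _+_ (proj₂ t) (proj₂ s))) Q) P

_^P_ : ∀ {n} → Poly n → ℕ → Poly n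
P ^P zero = one
P ^P suc k = P *P (P ^P k)

linear : ∀ {n} → (Fin n → ℕ) → Poly n
linear {n} c = map (λ i → (c i , unit i)) (allFin n)

-- coefficient of the monomial x^e in P (over ℕ, i.e. before reduction mod p)
coeff : ∀ {n} → Poly n → Monomial n → ℕ
coeff P e = sum (map proj₁ (filter (λ t → ≡-dec ℕₚ._≟_ (proj₂ t) e) P))

-- Variables x_1 … x_{p+1} are indexed by i : Fin (suc p), x_{k+1} ↔ index k.
-- L1 = x_1 + … + x_p
L1 : (p : ℕ) → Poly (suc p)
L1 p = linear (λ i → if toℕ i <ᵇ p then 1 else 0)

L2 : (p : ℕ) → Poly (suc p)
L2 p = linear (λ i → if toℕ i <ᵇ p then suc (toℕ i) else 1)

f : (p : ℕ) → Poly (suc p)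
f p = (L1 p ^P (p Data.Nat.∸ 1)) *P (L2 p ^P (p Data.Nat.∸ 1))

-- Write q = p − 1, L₁ = Σᵢ c₁ᵢ xᵢ and L₂ = Σᵢ c₂ᵢ xᵢ. Peeling off one linear factor at a time,
-- the coefficients of L₁ᵃ L₂ᵇ and the derivatives of a one-variable product satisfy the same
-- recursion, which gives the polarization identity
--   e! [xᵉ] L₁ᵃ L₂ᵇ = a! b! [tᵃ] Πᵢ (c₁ᵢ t + c₂ᵢ)^eᵢ      (|e| = a + b).
-- Coefficients with |e| ≠ 2q vanish by homogeneity. If |e| = 2q and every eᵢ ≥ 1, then every
-- eᵢ < p, so p ∤ e!, and the product on the right is Πᵢ (c₁ᵢ t + c₂ᵢ) = (t + 1) ⋯ (t + p) times a
-- polynomial of degree q − 2. The coefficients of (t + 1) ⋯ (t + p) in degrees 2, …, p − 1 are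
-- divisible by p: for Q = t (t + 1) ⋯ (t + q) one has Q (t + 1) = Q (t) + p (t + 1) ⋯ (t + q), and
-- comparing coefficients gives p ∣ [tᵏ] Q by downward induction on k, because p ∣ (p C k) for
-- 0 < k < p. Hence p divides [t^q] of the product, and so p ∣ [xᵉ] f.

module Submission where

open import Defs
open import Data.Nat using (ℕ; zero; suc; _+_; _*_; _∸_; _≤_; _<_; z≤n; s≤s; z<s; _!; _^_; pred; _<ᵇ_)
open import Data.Nat.Properties
open import Data.Nat.Combinatorics
  using (_C_; nCk+nC[k+1]≡[n+1]C[k+1]; nCk≡n!/k![n-k]!; k![n∸k]!∣n!; k>n⇒nCk≡0; nCn≡1; nC1≡n; nCk≡nC[n∸k])
open import Data.Nat.DivMod using (m/n*n≡m)
open import Data.Nat.Primality using (Prime; euclidsLemma; ¬prime[0]; ¬prime[1])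
open import Data.Nat.Tactic.RingSolver using (solve-∀)
open import Algebra.Properties.CommutativeSemigroup *-commutativeSemigroup using (x∙yz≈y∙xz)
import Data.Nat.ListAction as List
open import Data.Nat.ListAction.Properties using (sum-++)
open import Algebra.Properties.Semiring.Sum +-*-semiring
  using (sum; sum-syntax; sum-cong-≗; ∑-distrib-+; *-distribˡ-sum; sum-replicate-zero)
open import Data.Nat.Divisibility using (_∣_; _∣0; ∣-trans; m∣m*n; n∣m*n; ∣m∣n⇒∣m+n; ∣m+n∣m⇒∣n; ∣1⇒≡1; >⇒∤)
open import Data.Fin using (Fin; zero; suc; toℕ)
open import Data.Fin.Properties using (toℕ<n)
open import Data.Vec as Vec using (Vec; []; _∷_; lookup; replicate; zipWith; _[_]%=_)
import Data.Vec.Properties as Vecₚ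
open import Data.List
  using (List; []; _∷_; _++_; _∷ʳ_; map; concatMap; allFin; tabulate; length; applyUpTo; upTo)
import Data.List.Properties as Listₚ
open import Data.Product using (_×_; _,_; proj₁; proj₂)
open import Function using (_∘_)
open import Relation.Binary.PropositionalEquality
open import Relation.Nullary using (yes; no; ¬_)
open import Data.Sum using (inj₁; inj₂)
open import Data.Bool using (false; if_then_else_)
open import Data.Bool.Properties using (T-≡)
open import Function.Bundles using (Equivalence)
open import Data.Empty using (⊥-elim)

private
  variable
    A B : Set
    n : ℕ

∑ˡ : (A → ℕ) → List A → ℕ
∑ˡ g xs = List.sum (map g xs)

∑ˡ-cong : {g h : A → ℕ} → (∀ x → g x ≡ h x) → ∀ xs → ∑ˡ g xs ≡ ∑ˡ h xs
∑ˡ-cong g≗h xs = cong List.sum (Listₚ.map-cong g≗h xs)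

∑ˡ-map : (g : B → ℕ) (f : A → B) → ∀ xs → ∑ˡ g (map f xs) ≡ ∑ˡ (g ∘ f) xs
∑ˡ-map g f xs = cong List.sum (sym (Listₚ.map-∘ xs))

∑ˡ-concatMap : (g : B → ℕ) (f : A → List B) → ∀ xs →
               ∑ˡ g (concatMap f xs) ≡ ∑ˡ (λ x → ∑ˡ g (f x)) xs
∑ˡ-concatMap g f [] = refl
∑ˡ-concatMap g f (x ∷ xs) = begin
  List.sum (map g (f x ++ concatMap f xs))         ≡⟨ cong List.sum (Listₚ.map-++ g (f x) _) ⟩
  List.sum (map g (f x) ++ map g (concatMap f xs)) ≡⟨ sum-++ (map g (f x)) _ ⟩
  ∑ˡ g (f x) + ∑ˡ g (concatMap f xs)               ≡⟨ cong (∑ˡ g (f x) +_) (∑ˡ-concatMap g f xs) ⟩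
  ∑ˡ g (f x) + ∑ˡ (λ x → ∑ˡ g (f x)) xs            ∎
  where open ≡-Reasoning

∑ˡ-*ˡ : ∀ c (g : A → ℕ) xs → ∑ˡ (λ x → c * g x) xs ≡ c * ∑ˡ g xs
∑ˡ-*ˡ c g [] = sym (*-zeroʳ c)
∑ˡ-*ˡ c g (x ∷ xs) = trans (cong (c * g x +_) (∑ˡ-*ˡ c g xs)) (sym (*-distribˡ-+ c (g x) _))

∑ˡ-tabulate : (g : A → ℕ) (f : Fin n → A) → ∑ˡ g (tabulate f) ≡ ∑[ i < n ] g (f i)
∑ˡ-tabulate {n = zero} g f = refl
∑ˡ-tabulate {n = suc n} g f = cong (g (f zero) +_) (∑ˡ-tabulate g (f ∘ suc))

∑-zero : {g : Fin n → ℕ} → (∀ i → g i ≡ 0) → ∑[ i < n ] g i ≡ 0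
∑-zero {n} g≡0 = trans (sum-cong-≗ g≡0) (sum-replicate-zero n)

-- Coefficients of products

δ : ℕ → ℕ → ℕ
δ zero    zero    = 1
δ zero    (suc _) = 0
δ (suc _) zero    = 0
δ (suc a) (suc b) = δ a b

δ-refl : ∀ a → δ a a ≡ 1
δ-refl zero    = refl
δ-refl (suc a) = δ-refl a

δ-≢ : ∀ {a b} → a ≢ b → δ a b ≡ 0
δ-≢ {zero}  {zero}  a≢b = ⊥-elim (a≢b refl)
δ-≢ {zero}  {suc b} a≢b = refl
δ-≢ {suc a} {zero}  a≢b = refl
δ-≢ {suc a} {suc b} a≢b = δ-≢ (a≢b ∘ cong suc)

δᵐ : Monomial n → Monomial n → ℕ
δᵐ []       []       = 1
δᵐ (a ∷ as) (b ∷ bs) = δ a b * δᵐ as bs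

δᵐ-refl : (m : Monomial n) → δᵐ m m ≡ 1
δᵐ-refl []      = refl
δᵐ-refl (a ∷ m) rewrite δ-refl a | δᵐ-refl m = refl

δᵐ-≢ : {m e : Monomial n} → m ≢ e → δᵐ m e ≡ 0
δᵐ-≢ {m = []}    {[]}    m≢e = ⊥-elim (m≢e refl)
δᵐ-≢ {m = a ∷ m} {b ∷ e} m≢e with a ≟ b
... | yes refl rewrite δ-refl a = trans (+-identityʳ _) (δᵐ-≢ (m≢e ∘ cong (a ∷_)))
... | no a≢b   rewrite δ-≢ a≢b  = refl

Term : ℕ → Set
Term n = ℕ × Monomial n

weight : Monomial n → Term n → ℕ
weight e t = proj₁ t * δᵐ (proj₂ t) e

coeff≡∑weight : (P : Poly n) (e : Monomial n) → coeff P e ≡ ∑ˡ (weight e) P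
coeff≡∑weight []            e = refl
coeff≡∑weight ((c , m) ∷ P) e with Vecₚ.≡-dec _≟_ m e
... | yes refl rewrite δᵐ-refl m | *-identityʳ c = cong (c +_) (coeff≡∑weight P m)
... | no m≢e   rewrite δᵐ-≢ m≢e  | *-zeroʳ c     = coeff≡∑weight P e

_·ᵗ_ : Term n → Term n → Term n
t ·ᵗ s = proj₁ t * proj₁ s , zipWith _+_ (proj₂ t) (proj₂ s)

∑ˡ-*P : (g : Term n → ℕ) (P Q : Poly n) →
        ∑ˡ g (P *P Q) ≡ ∑ˡ (λ t → ∑ˡ (λ s → g (t ·ᵗ s)) Q) P
∑ˡ-*P g P Q = trans (∑ˡ-concatMap g _ P) (∑ˡ-cong (λ t → ∑ˡ-map g (t ·ᵗ_) Q) P)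

·ᵗ-assoc : (t s r : Term n) → (t ·ᵗ s) ·ᵗ r ≡ t ·ᵗ (s ·ᵗ r)
·ᵗ-assoc t s r =
  cong₂ _,_ (*-assoc (proj₁ t) _ _) (Vecₚ.zipWith-assoc +-assoc (proj₂ t) (proj₂ s) (proj₂ r))

·ᵗ-identityˡ : (s : Term n) → (1 , replicate n 0) ·ᵗ s ≡ s
·ᵗ-identityˡ s = cong₂ _,_ (*-identityˡ (proj₁ s)) (Vecₚ.zipWith-identityˡ +-identityˡ (proj₂ s))

infix 4 _≈ᶜ_

_≈ᶜ_ : Poly n → Poly n → Set
P ≈ᶜ Q = ∀ e → coeff P e ≡ coeff Q e

*P-identityˡ : (Q : Poly n) → one *P Q ≈ᶜ Q
*P-identityˡ Q e = begin
  coeff (one *P Q) e                                  ≡⟨ coeff≡∑weight (one *P Q) e ⟩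
  ∑ˡ (weight e) (one *P Q)                            ≡⟨ ∑ˡ-*P (weight e) one Q ⟩
  ∑ˡ (λ s → weight e ((1 , replicate _ 0) ·ᵗ s)) Q + 0 ≡⟨ +-identityʳ _ ⟩
  ∑ˡ (λ s → weight e ((1 , replicate _ 0) ·ᵗ s)) Q     ≡⟨ ∑ˡ-cong (cong (weight e) ∘ ·ᵗ-identityˡ) Q ⟩
  ∑ˡ (weight e) Q                                     ≡⟨ coeff≡∑weight Q e ⟨
  coeff Q e                                           ∎
  where open ≡-Reasoning

*P-assoc : (P Q R : Poly n) → (P *P Q) *P R ≈ᶜ P *P (Q *P R)
*P-assoc P Q R e = begin
  coeff ((P *P Q) *P R) e
    ≡⟨ coeff≡∑weight ((P *P Q) *P R) e ⟩
  ∑ˡ (weight e) ((P *P Q) *P R)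
    ≡⟨ ∑ˡ-*P (weight e) (P *P Q) R ⟩
  ∑ˡ (λ u → ∑ˡ (λ r → weight e (u ·ᵗ r)) R) (P *P Q)
    ≡⟨ ∑ˡ-*P _ P Q ⟩
  ∑ˡ (λ t → ∑ˡ (λ s → ∑ˡ (λ r → weight e ((t ·ᵗ s) ·ᵗ r)) R) Q) P
    ≡⟨ ∑ˡ-cong (λ t → ∑ˡ-cong (λ s → ∑ˡ-cong (λ r → cong (weight e) (·ᵗ-assoc t s r)) R) Q) P ⟩
  ∑ˡ (λ t → ∑ˡ (λ s → ∑ˡ (λ r → weight e (t ·ᵗ (s ·ᵗ r))) R) Q) P
    ≡⟨ ∑ˡ-cong (λ t → ∑ˡ-*P _ Q R) P ⟨
  ∑ˡ (λ t → ∑ˡ (λ v → weight e (t ·ᵗ v)) (Q *P R)) P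
    ≡⟨ ∑ˡ-*P (weight e) P (Q *P R) ⟨
  ∑ˡ (weight e) (P *P (Q *P R))
    ≡⟨ coeff≡∑weight (P *P (Q *P R)) e ⟨
  coeff (P *P (Q *P R)) e
    ∎
  where open ≡-Reasoning

sgn : ℕ → ℕ
sgn zero    = 0
sgn (suc _) = 1

lower : Monomial n → Fin n → Monomial n
lower e i = e [ i ]%= pred

δᵐ-unit : (i : Fin n) (m e : Monomial n) →
          δᵐ (zipWith _+_ (unit i) m) e ≡ sgn (lookup e i) * δᵐ m (lower e i)
δᵐ-unit zero    (a ∷ m) (zero  ∷ e) = refl
δᵐ-unit zero    (a ∷ m) (suc b ∷ e) =
  trans (cong (δ a b *_) (cong (λ m′ → δᵐ m′ e) (Vecₚ.zipWith-identityˡ +-identityˡ m)))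
        (sym (+-identityʳ _))
δᵐ-unit (suc i) (a ∷ m) (b ∷ e) rewrite δᵐ-unit i m e = x∙yz≈y∙xz (δ a b) (sgn (lookup e i)) _

-- The factor sgn kills the junk term: for lookup e i ≡ 0, lower e i is e itself.
coeff-linear-*P : (c : Fin n → ℕ) (Q : Poly n) (e : Monomial n) →
  coeff (linear c *P Q) e ≡ ∑[ i < n ] (c i * (sgn (lookup e i) * coeff Q (lower e i)))
coeff-linear-*P {n} c Q e = begin
  coeff (linear c *P Q) e
    ≡⟨ coeff≡∑weight (linear c *P Q) e ⟩
  ∑ˡ (weight e) (linear c *P Q)
    ≡⟨ ∑ˡ-*P (weight e) (linear c) Q ⟩
  ∑ˡ (λ t → ∑ˡ (λ s → weight e (t ·ᵗ s)) Q) (linear c)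
    ≡⟨ ∑ˡ-map _ (λ i → c i , unit i) (allFin n) ⟩
  ∑ˡ (λ i → ∑ˡ (λ s → weight e ((c i , unit i) ·ᵗ s)) Q) (allFin n)
    ≡⟨ ∑ˡ-tabulate {n = n} _ (λ i → i) ⟩
  ∑[ i < n ] (∑ˡ (λ s → weight e ((c i , unit i) ·ᵗ s)) Q)
    ≡⟨ sum-cong-≗ term ⟩
  ∑[ i < n ] (c i * (sgn (lookup e i) * coeff Q (lower e i)))
    ∎
  where
  open ≡-Reasoning
  term : ∀ i → ∑ˡ (λ s → weight e ((c i , unit i) ·ᵗ s)) Q
             ≡ c i * (sgn (lookup e i) * coeff Q (lower e i))
  term i = begin
    ∑ˡ (λ s → (c i * proj₁ s) * δᵐ (zipWith _+_ (unit i) (proj₂ s)) e) Q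
      ≡⟨ ∑ˡ-cong (λ s → trans (cong ((c i * proj₁ s) *_) (δᵐ-unit i (proj₂ s) e))
                              (regroup (c i) (proj₁ s) (sgn (lookup e i)) _)) Q ⟩
    ∑ˡ (λ s → c i * (sgn (lookup e i) * weight (lower e i) s)) Q
      ≡⟨ ∑ˡ-*ˡ (c i) _ Q ⟩
    c i * ∑ˡ (λ s → sgn (lookup e i) * weight (lower e i) s) Q
      ≡⟨ cong (c i *_) (∑ˡ-*ˡ (sgn (lookup e i)) (weight (lower e i)) Q) ⟩
    c i * (sgn (lookup e i) * ∑ˡ (weight (lower e i)) Q)
      ≡⟨ cong (λ z → c i * (sgn (lookup e i) * z)) (coeff≡∑weight Q (lower e i)) ⟨
    c i * (sgn (lookup e i) * coeff Q (lower e i))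
      ∎
    where
    regroup : ∀ a b x y → (a * b) * (x * y) ≡ a * (x * (b * y))
    regroup = solve-∀

degree : Monomial n → ℕ
degree e = sum (lookup e)

_!ᵐ : Monomial n → ℕ
[]      !ᵐ = 1
(x ∷ e) !ᵐ = x ! * e !ᵐ

_^ᵐ_ : (Fin n → ℕ) → Monomial n → ℕ
c ^ᵐ []      = 1
c ^ᵐ (x ∷ e) = c zero ^ x * (c ∘ suc) ^ᵐ e

degree-lower : (e : Monomial n) (i : Fin n) {k : ℕ} → lookup e i ≡ suc k →
               degree e ≡ suc (degree (lower e i))
degree-lower (suc x ∷ e) zero    refl = refl
degree-lower (x     ∷ e) (suc i) eᵢ≡1+k = trans (cong (x +_) (degree-lower e i eᵢ≡1+k)) (+-suc x _)

degree-replicate : ∀ n → degree (replicate n 0) ≡ 0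
degree-replicate zero    = refl
degree-replicate (suc n) = degree-replicate n

degree≡0 : (e : Monomial n) → degree e ≡ 0 → e ≡ replicate n 0
degree≡0 []         _       = refl
degree≡0 (zero ∷ e) ∣e∣≡0 = cong (0 ∷_) (degree≡0 e ∣e∣≡0)

!ᵐ-lower : (e : Monomial n) (i : Fin n) → e !ᵐ * sgn (lookup e i) ≡ lookup e i * lower e i !ᵐ
!ᵐ-lower (zero  ∷ e) zero    = *-zeroʳ ((zero ∷ e) !ᵐ)
!ᵐ-lower (suc x ∷ e) zero    = trans (*-identityʳ _) (*-assoc (suc x) (x !) (e !ᵐ))
!ᵐ-lower (x     ∷ e) (suc i) = begin
  (x ! * e !ᵐ) * sgn (lookup e i)   ≡⟨ *-assoc (x !) _ _ ⟩
  x ! * (e !ᵐ * sgn (lookup e i))   ≡⟨ cong (x ! *_) (!ᵐ-lower e i) ⟩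
  x ! * (lookup e i * lower e i !ᵐ) ≡⟨ x∙yz≈y∙xz (x !) (lookup e i) _ ⟩
  lookup e i * (x ! * lower e i !ᵐ) ∎
  where open ≡-Reasoning

^ᵐ-lower : (c : Fin n → ℕ) (e : Monomial n) (i : Fin n) {k : ℕ} → lookup e i ≡ suc k →
           c i * c ^ᵐ lower e i ≡ c ^ᵐ e
^ᵐ-lower c (suc x ∷ e) zero    refl = sym (*-assoc (c zero) (c zero ^ x) _)
^ᵐ-lower c (x     ∷ e) (suc i) eᵢ≡1+k =
  trans (x∙yz≈y∙xz (c (suc i)) (c zero ^ x) _) (cong (c zero ^ x *_) (^ᵐ-lower (c ∘ suc) e i eᵢ≡1+k))

!ᵐ-replicate : ∀ n → replicate n 0 !ᵐ ≡ 1
!ᵐ-replicate zero    = refl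
!ᵐ-replicate (suc n) = trans (+-identityʳ _) (!ᵐ-replicate n)

^ᵐ-replicate : (c : Fin n → ℕ) → c ^ᵐ replicate n 0 ≡ 1
^ᵐ-replicate {zero}  c = refl
^ᵐ-replicate {suc n} c = trans (+-identityʳ _) (^ᵐ-replicate (c ∘ suc))

n≤degree : (e : Monomial n) → (∀ i → 1 ≤ lookup e i) → n ≤ degree e
n≤degree []      _   = z≤n
n≤degree (x ∷ e) e≥1 = +-mono-≤ (e≥1 zero) (n≤degree e (e≥1 ∘ suc))

lookup+n≤degree : (e : Monomial (suc n)) → (∀ i → 1 ≤ lookup e i) → ∀ i → lookup e i + n ≤ degree e
lookup+n≤degree         (x ∷ e) e≥1 zero    = +-monoʳ-≤ x (n≤degree e (e≥1 ∘ suc))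
lookup+n≤degree {suc n} (x ∷ e) e≥1 (suc i) =
  ≤-trans (≤-reflexive (+-suc (lookup e i) n)) (+-mono-≤ (e≥1 zero) (lookup+n≤degree e (e≥1 ∘ suc) i))

degree-map-suc : (e : Monomial n) → degree (Vec.map suc e) ≡ degree e + n
degree-map-suc []              = refl
degree-map-suc {suc n} (x ∷ e) = trans (cong (λ d → suc (x + d)) (degree-map-suc e)) (regroup x (degree e) n)
  where
  regroup : ∀ x d n → suc (x + (d + n)) ≡ (x + d) + suc n
  regroup = solve-∀

map-suc-pred : (e : Monomial n) → (∀ i → 1 ≤ lookup e i) → Vec.map suc (Vec.map pred e) ≡ e
map-suc-pred []          _   = refl
map-suc-pred (suc x ∷ e) e≥1 = cong (suc x ∷_) (map-suc-pred e (e≥1 ∘ suc))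
map-suc-pred (zero  ∷ e) e≥1 with e≥1 zero
... | ()

!ᵐ-*-∑-lower : (e : Monomial n) (c X : Fin n → ℕ) →
  e !ᵐ * ∑[ i < n ] (c i * (sgn (lookup e i) * X i))
    ≡ ∑[ i < n ] (c i * (lookup e i * (lower e i !ᵐ * X i)))
!ᵐ-*-∑-lower {n} e c X = trans (*-distribˡ-sum {n} (e !ᵐ) _) (sum-cong-≗ {n} term)
  where
  term : ∀ i → e !ᵐ * (c i * (sgn (lookup e i) * X i))
             ≡ c i * (lookup e i * (lower e i !ᵐ * X i))
  term i = begin
    e !ᵐ * (c i * (sgn (lookup e i) * X i)) ≡⟨ regroup (e !ᵐ) (c i) _ (X i) ⟩
    c i * ((e !ᵐ * sgn (lookup e i)) * X i) ≡⟨ cong (λ z → c i * (z * X i)) (!ᵐ-lower e i) ⟩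
    c i * ((lookup e i * lower e i !ᵐ) * X i) ≡⟨ cong (c i *_) (*-assoc (lookup e i) _ (X i)) ⟩
    c i * (lookup e i * (lower e i !ᵐ * X i)) ∎
    where
    open ≡-Reasoning
    regroup : ∀ f c s x → f * (c * (s * x)) ≡ c * ((f * s) * x)
    regroup = solve-∀

-- Homogeneity and the multinomial theorem

coeff-one : (e : Monomial n) → coeff (one {n}) e ≡ δᵐ (replicate n 0) e
coeff-one {n} e = trans (coeff≡∑weight (one {n}) e) (trans (+-identityʳ _) (*-identityˡ _))

Homogeneous : ℕ → Poly n → Set
Homogeneous d P = ∀ e → degree e ≢ d → coeff P e ≡ 0

one-homogeneous : Homogeneous 0 (one {n})
one-homogeneous {n} e ∣e∣≢0 =
  trans (coeff-one e)
        (δᵐ-≢ {m = replicate n 0} λ 0≡e → ∣e∣≢0 (trans (cong (degree {n}) (sym 0≡e)) (degree-replicate n)))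

linear-*P-homogeneous : ∀ {d} (c : Fin n → ℕ) {Q : Poly n} → Homogeneous d Q →
                        Homogeneous (suc d) (linear c *P Q)
linear-*P-homogeneous {d = d} c {Q} homQ e ∣e∣≢1+d =
  trans (coeff-linear-*P c Q e) (∑-zero term)
  where
  term : ∀ i → c i * (sgn (lookup e i) * coeff Q (lower e i)) ≡ 0
  term i with lookup e i in eᵢ≡
  ... | zero  = *-zeroʳ (c i)
  ... | suc k rewrite homQ (lower e i) (λ ∣e′∣≡d → ∣e∣≢1+d (trans (degree-lower e i eᵢ≡) (cong suc ∣e′∣≡d)))
              = *-zeroʳ (c i)

^P-homogeneous : (c : Fin n → ℕ) (b : ℕ) → Homogeneous b (linear c ^P b)
^P-homogeneous c zero    = one-homogeneous
^P-homogeneous c (suc b) = linear-*P-homogeneous c (^P-homogeneous c b)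

^P-*P-homogeneous : ∀ {d} (c : Fin n → ℕ) (a : ℕ) {Q : Poly n} → Homogeneous d Q →
                    Homogeneous (a + d) ((linear c ^P a) *P Q)
^P-*P-homogeneous c zero    {Q} homQ e ∣e∣≢d = trans (*P-identityˡ Q e) (homQ e ∣e∣≢d)
^P-*P-homogeneous c (suc a) {Q} homQ e ∣e∣≢ =
  trans (*P-assoc (linear c) (linear c ^P a) Q e)
        (linear-*P-homogeneous c (^P-*P-homogeneous c a homQ) e ∣e∣≢)

*-cong-positive : ∀ m {x y} → (∀ {k} → m ≡ suc k → x ≡ y) → m * x ≡ m * y
*-cong-positive zero    _   = refl
*-cong-positive (suc k) x≡y = cong (suc k *_) (x≡y refl)

multinomial : (c : Fin n → ℕ) (b : ℕ) (e : Monomial n) → degree e ≡ b →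
              e !ᵐ * coeff (linear c ^P b) e ≡ b ! * c ^ᵐ e
multinomial {n} c zero e ∣e∣≡0 with degree≡0 e ∣e∣≡0
... | refl rewrite coeff-one (replicate n 0) | δᵐ-refl (replicate n 0) | !ᵐ-replicate n | ^ᵐ-replicate c
           = refl
multinomial {n} c (suc b) e ∣e∣≡1+b = begin
  e !ᵐ * coeff (linear c ^P suc b) e
    ≡⟨ cong (e !ᵐ *_) (coeff-linear-*P c (linear c ^P b) e) ⟩
  e !ᵐ * ∑[ i < n ] (c i * (sgn (lookup e i) * coeff (linear c ^P b) (lower e i)))
    ≡⟨ !ᵐ-*-∑-lower e c _ ⟩
  ∑[ i < n ] (c i * (lookup e i * (lower e i !ᵐ * coeff (linear c ^P b) (lower e i))))
    ≡⟨ sum-cong-≗ {n} term ⟩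
  ∑[ i < n ] (K * lookup e i)
    ≡⟨ *-distribˡ-sum {n} K (lookup e) ⟨
  K * degree e
    ≡⟨ cong (K *_) ∣e∣≡1+b ⟩
  K * suc b
    ≡⟨ regroup (b !) (c ^ᵐ e) b ⟩
  suc b ! * c ^ᵐ e
    ∎
  where
  open ≡-Reasoning
  K = b ! * c ^ᵐ e
  regroup : ∀ f v b → (f * v) * suc b ≡ (suc b * f) * v
  regroup = solve-∀
  term : ∀ i → c i * (lookup e i * (lower e i !ᵐ * coeff (linear c ^P b) (lower e i))) ≡ K * lookup e i
  term i = begin
    c i * (lookup e i * (lower e i !ᵐ * coeff (linear c ^P b) (lower e i)))
      ≡⟨ x∙yz≈y∙xz (c i) (lookup e i) _ ⟩
    lookup e i * (c i * (lower e i !ᵐ * coeff (linear c ^P b) (lower e i)))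
      ≡⟨ *-cong-positive (lookup e i) lowered ⟩
    lookup e i * K
      ≡⟨ *-comm (lookup e i) K ⟩
    K * lookup e i
      ∎
    where
    lowered : ∀ {k} → lookup e i ≡ suc k → c i * (lower e i !ᵐ * coeff (linear c ^P b) (lower e i)) ≡ K
    lowered eᵢ≡1+k = begin
      c i * (lower e i !ᵐ * coeff (linear c ^P b) (lower e i))
        ≡⟨ cong (c i *_) (multinomial c b (lower e i)
                            (suc-injective (trans (sym (degree-lower e i eᵢ≡1+k)) ∣e∣≡1+b))) ⟩
      c i * (b ! * c ^ᵐ lower e i)
        ≡⟨ x∙yz≈y∙xz (c i) (b !) _ ⟩
      b ! * (c i * c ^ᵐ lower e i)
        ≡⟨ cong (b ! *_) (^ᵐ-lower c e i eᵢ≡1+k) ⟩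
      K ∎

-- Univariate polynomials in t, as coefficient sequences: mulLinear α β X is (α t + β) X,
-- mulLinear^ α β x X is (α t + β)ˣ X, and mulPowers c₁ c₂ e X is X Πᵢ (c₁ᵢ t + c₂ᵢ)^eᵢ.
Coeffs : Set
Coeffs = ℕ → ℕ

mulLinear : ℕ → ℕ → Coeffs → Coeffs
mulLinear α β X zero    = β * X zero
mulLinear α β X (suc k) = β * X (suc k) + α * X k

mulLinear-cong : ∀ α β {X Y : Coeffs} → X ≗ Y → mulLinear α β X ≗ mulLinear α β Y
mulLinear-cong α β X≗Y zero    = cong (β *_) (X≗Y zero)
mulLinear-cong α β X≗Y (suc k) = cong₂ (λ u v → β * u + α * v) (X≗Y (suc k)) (X≗Y k)

mulLinear-+ : ∀ α β (X Y : Coeffs) k →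
              mulLinear α β (λ j → X j + Y j) k ≡ mulLinear α β X k + mulLinear α β Y k
mulLinear-+ α β X Y zero    = *-distribˡ-+ β (X zero) (Y zero)
mulLinear-+ α β X Y (suc k) = distrib α β (X k) (Y k) (X (suc k)) (Y (suc k))
  where
  distrib : ∀ α β x y x′ y′ → β * (x′ + y′) + α * (x + y) ≡ (β * x′ + α * x) + (β * y′ + α * y)
  distrib = solve-∀

mulLinear-* : ∀ α β c (X : Coeffs) k → mulLinear α β (λ j → c * X j) k ≡ c * mulLinear α β X k
mulLinear-* α β c X zero    = x∙yz≈y∙xz β c (X zero)
mulLinear-* α β c X (suc k) =
  trans (cong₂ _+_ (x∙yz≈y∙xz β c _) (x∙yz≈y∙xz α c _)) (sym (*-distribˡ-+ c _ _))

mulLinear-∑ : ∀ α β (G : Fin n → Coeffs) k →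
              mulLinear α β (λ j → ∑[ i < n ] G i j) k ≡ ∑[ i < n ] mulLinear α β (G i) k
mulLinear-∑ {zero}  α β G zero    = *-zeroʳ β
mulLinear-∑ {zero}  α β G (suc k) = cong₂ _+_ (*-zeroʳ β) (*-zeroʳ α)
mulLinear-∑ {suc n} α β G k =
  trans (mulLinear-+ α β (G zero) (λ j → ∑[ i < n ] G (suc i) j) k)
        (cong (mulLinear α β (G zero) k +_) (mulLinear-∑ α β (G ∘ suc) k))

mulLinear-comm : ∀ α β α′ β′ (X : Coeffs) →
                 mulLinear α β (mulLinear α′ β′ X) ≗ mulLinear α′ β′ (mulLinear α β X)
mulLinear-comm α β α′ β′ X zero          = x∙yz≈y∙xz β β′ (X zero)
mulLinear-comm α β α′ β′ X (suc zero)    = swap α β α′ β′ (X 0) (X 1)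
  where
  swap : ∀ α β α′ β′ x₀ x₁ → β * (β′ * x₁ + α′ * x₀) + α * (β′ * x₀) ≡ β′ * (β * x₁ + α * x₀) + α′ * (β * x₀)
  swap = solve-∀
mulLinear-comm α β α′ β′ X (suc (suc k)) = swap α β α′ β′ (X k) (X (suc k)) (X (suc (suc k)))
  where
  swap : ∀ α β α′ β′ x₀ x₁ x₂ →
         β * (β′ * x₂ + α′ * x₁) + α * (β′ * x₁ + α′ * x₀) ≡ β′ * (β * x₂ + α * x₁) + α′ * (β * x₁ + α * x₀)
  swap = solve-∀

mulLinear^ : ℕ → ℕ → ℕ → Coeffs → Coeffs
mulLinear^ α β zero    X = X
mulLinear^ α β (suc x) X = mulLinear α β (mulLinear^ α β x X)

mulLinear^-cong : ∀ α β x {X Y : Coeffs} → X ≗ Y → mulLinear^ α β x X ≗ mulLinear^ α β x Y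
mulLinear^-cong α β zero    X≗Y = X≗Y
mulLinear^-cong α β (suc x) X≗Y = mulLinear-cong α β (mulLinear^-cong α β x X≗Y)

mulLinear^-* : ∀ α β x c (X : Coeffs) k → mulLinear^ α β x (λ j → c * X j) k ≡ c * mulLinear^ α β x X k
mulLinear^-* α β zero    c X k = refl
mulLinear^-* α β (suc x) c X k =
  trans (mulLinear-cong α β (mulLinear^-* α β x c X) k) (mulLinear-* α β c _ k)

mulLinear^-∑ : ∀ α β x (G : Fin n → Coeffs) k →
               mulLinear^ α β x (λ j → ∑[ i < n ] G i j) k ≡ ∑[ i < n ] mulLinear^ α β x (G i) k
mulLinear^-∑ α β zero    G k = refl
mulLinear^-∑ α β (suc x) G k =
  trans (mulLinear-cong α β (mulLinear^-∑ α β x G) k) (mulLinear-∑ α β (λ i → mulLinear^ α β x (G i)) k)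

mulLinear^-comm : ∀ x α β α′ β′ (X : Coeffs) →
                  mulLinear α β (mulLinear^ α′ β′ x X) ≗ mulLinear^ α′ β′ x (mulLinear α β X)
mulLinear^-comm zero    α β α′ β′ X k = refl
mulLinear^-comm (suc x) α β α′ β′ X k =
  trans (mulLinear-comm α β α′ β′ _ k) (mulLinear-cong α′ β′ (mulLinear^-comm x α β α′ β′ X) k)

mulPowers : (c₁ c₂ : Fin n → ℕ) → Monomial n → Coeffs → Coeffs
mulPowers c₁ c₂ []      X = X
mulPowers c₁ c₂ (x ∷ e) X = mulLinear^ (c₁ zero) (c₂ zero) x (mulPowers (c₁ ∘ suc) (c₂ ∘ suc) e X)

powerProduct : (c₁ c₂ : Fin n → ℕ) → Monomial n → Coeffs
powerProduct c₁ c₂ e = mulPowers c₁ c₂ e (δ 0)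

powerProduct-constant : (c₁ c₂ : Fin n → ℕ) (e : Monomial n) → powerProduct c₁ c₂ e 0 ≡ c₂ ^ᵐ e
powerProduct-constant c₁ c₂ []      = refl
powerProduct-constant c₁ c₂ (x ∷ e) = go x
  where
  go : ∀ x → mulLinear^ (c₁ zero) (c₂ zero) x (powerProduct (c₁ ∘ suc) (c₂ ∘ suc) e) 0
             ≡ c₂ zero ^ x * (c₂ ∘ suc) ^ᵐ e
  go zero    = trans (powerProduct-constant (c₁ ∘ suc) (c₂ ∘ suc) e) (sym (+-identityʳ _))
  go (suc x) = trans (cong (c₂ zero *_) (go x)) (sym (*-assoc (c₂ zero) _ _))

deriv : Coeffs → Coeffs
deriv X k = suc k * X (suc k)

deriv-mulLinear : ∀ α β (X : Coeffs) k → deriv (mulLinear α β X) k ≡ α * X k + mulLinear α β (deriv X) k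
deriv-mulLinear α β X zero    = leibniz₀ α β (X 0) (X 1)
  where
  leibniz₀ : ∀ α β x₀ x₁ → (β * x₁ + α * x₀) + 0 ≡ α * x₀ + β * (x₁ + 0)
  leibniz₀ = solve-∀
deriv-mulLinear α β X (suc k) = leibniz α β k (X (suc k)) (X (suc (suc k)))
  where
  leibniz : ∀ α β k x₁ x₂ → suc (suc k) * (β * x₂ + α * x₁)
                            ≡ α * x₁ + (β * (suc (suc k) * x₂) + α * (suc k * x₁))
  leibniz = solve-∀

deriv-mulLinear^ : ∀ α β x (Y : Coeffs) k →
  deriv (mulLinear^ α β x Y) k ≡ α * (x * mulLinear^ α β (pred x) Y k) + mulLinear^ α β x (deriv Y) k
deriv-mulLinear^ α β zero    Y k = cong (_+ deriv Y k) (sym (*-zeroʳ α))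
deriv-mulLinear^ α β (suc y) Y k = begin
  deriv (mulLinear α β F) k
    ≡⟨ deriv-mulLinear α β F k ⟩
  α * F k + mulLinear α β (deriv F) k
    ≡⟨ cong (α * F k +_) (mulLinear-cong α β (deriv-mulLinear^ α β y Y) k) ⟩
  α * F k + mulLinear α β (λ j → α * (y * mulLinear^ α β (pred y) Y j) + G j) k
    ≡⟨ cong (α * F k +_) (mulLinear-+ α β _ G k) ⟩
  α * F k + (mulLinear α β (λ j → α * (y * mulLinear^ α β (pred y) Y j)) k + mulLinear α β G k)
    ≡⟨ cong (λ z → α * F k + (z + mulLinear α β G k))
            (trans (mulLinear-* α β α _ k) (cong (α *_) (mulLinear-* α β y _ k))) ⟩
  α * F k + (α * (y * mulLinear α β (mulLinear^ α β (pred y) Y) k) + mulLinear α β G k)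
    ≡⟨ cong (λ z → α * F k + (α * z + mulLinear α β G k)) (undo-pred y) ⟩
  α * F k + (α * (y * F k) + mulLinear α β G k)
    ≡⟨ regroup α y (F k) _ ⟩
  α * (suc y * F k) + mulLinear α β G k
    ∎
  where
  open ≡-Reasoning
  F = mulLinear^ α β y Y
  G = mulLinear^ α β y (deriv Y)
  undo-pred : ∀ y → y * mulLinear α β (mulLinear^ α β (pred y) Y) k ≡ y * mulLinear^ α β y Y k
  undo-pred zero    = refl
  undo-pred (suc y) = refl
  regroup : ∀ α y f g → α * f + (α * (y * f) + g) ≡ α * (suc y * f) + g
  regroup = solve-∀

deriv-powerProduct : (c₁ c₂ : Fin n → ℕ) (e : Monomial n) (k : ℕ) →
  deriv (powerProduct c₁ c₂ e) k ≡ ∑[ i < n ] (c₁ i * (lookup e i * powerProduct c₁ c₂ (lower e i) k))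
deriv-powerProduct c₁ c₂ []      k = *-zeroʳ (suc k)
deriv-powerProduct {suc n} c₁ c₂ (x ∷ e) k = begin
  deriv (mulLinear^ α β x P) k
    ≡⟨ deriv-mulLinear^ α β x P k ⟩
  α * (x * mulLinear^ α β (pred x) P k) + mulLinear^ α β x (deriv P) k
    ≡⟨ cong (head +_) (mulLinear^-cong α β x (deriv-powerProduct (c₁ ∘ suc) (c₂ ∘ suc) e) k) ⟩
  head + mulLinear^ α β x (λ j → ∑[ i < n ] (c₁ (suc i) * (lookup e i * P′ i j))) k
    ≡⟨ cong (head +_) (mulLinear^-∑ {n} α β x _ k) ⟩
  head + ∑[ i < n ] mulLinear^ α β x (λ j → c₁ (suc i) * (lookup e i * P′ i j)) k
    ≡⟨ cong (head +_) (sum-cong-≗ {n} λ i →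
         trans (mulLinear^-* α β x (c₁ (suc i)) _ k)
               (cong (c₁ (suc i) *_) (mulLinear^-* α β x (lookup e i) _ k))) ⟩
  head + ∑[ i < n ] (c₁ (suc i) * (lookup e i * mulLinear^ α β x (P′ i) k))
    ∎
  where
  open ≡-Reasoning
  α = c₁ zero
  β = c₂ zero
  P = powerProduct (c₁ ∘ suc) (c₂ ∘ suc) e
  P′ : Fin n → Coeffs
  P′ i = powerProduct (c₁ ∘ suc) (c₂ ∘ suc) (lower e i)
  head = α * (x * mulLinear^ α β (pred x) P k)

polarization : (c₁ c₂ : Fin n → ℕ) (a b : ℕ) (e : Monomial n) → degree e ≡ a + b →
  e !ᵐ * coeff ((linear c₁ ^P a) *P (linear c₂ ^P b)) e ≡ (a ! * b !) * powerProduct c₁ c₂ e a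
polarization c₁ c₂ zero b e ∣e∣≡b = begin
  e !ᵐ * coeff (one *P (linear c₂ ^P b)) e  ≡⟨ cong (e !ᵐ *_) (*P-identityˡ (linear c₂ ^P b) e) ⟩
  e !ᵐ * coeff (linear c₂ ^P b) e           ≡⟨ multinomial c₂ b e ∣e∣≡b ⟩
  b ! * c₂ ^ᵐ e                             ≡⟨ cong₂ _*_ (+-identityʳ (b !)) (powerProduct-constant c₁ c₂ e) ⟨
  (1 * b !) * powerProduct c₁ c₂ e 0        ∎
  where open ≡-Reasoning
polarization {n} c₁ c₂ (suc a) b e ∣e∣≡ = begin
  e !ᵐ * coeff ((linear c₁ *P (linear c₁ ^P a)) *P Q) e
    ≡⟨ cong (e !ᵐ *_) (*P-assoc (linear c₁) (linear c₁ ^P a) Q e) ⟩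
  e !ᵐ * coeff (linear c₁ *P S) e
    ≡⟨ cong (e !ᵐ *_) (coeff-linear-*P c₁ S e) ⟩
  e !ᵐ * ∑[ i < n ] (c₁ i * (sgn (lookup e i) * coeff S (lower e i)))
    ≡⟨ !ᵐ-*-∑-lower e c₁ _ ⟩
  ∑[ i < n ] (c₁ i * (lookup e i * (lower e i !ᵐ * coeff S (lower e i))))
    ≡⟨ sum-cong-≗ {n} term ⟩
  ∑[ i < n ] (K * (c₁ i * (lookup e i * powerProduct c₁ c₂ (lower e i) a)))
    ≡⟨ *-distribˡ-sum {n} K _ ⟨
  K * ∑[ i < n ] (c₁ i * (lookup e i * powerProduct c₁ c₂ (lower e i) a))
    ≡⟨ cong (K *_) (deriv-powerProduct c₁ c₂ e a) ⟨
  K * (suc a * powerProduct c₁ c₂ e (suc a))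
    ≡⟨ regroup (a !) (b !) a _ ⟩
  (suc a ! * b !) * powerProduct c₁ c₂ e (suc a)
    ∎
  where
  open ≡-Reasoning
  Q = linear c₂ ^P b
  S = (linear c₁ ^P a) *P Q
  K = a ! * b !
  regroup : ∀ f g a v → (f * g) * (suc a * v) ≡ ((suc a * f) * g) * v
  regroup = solve-∀
  term : ∀ i → c₁ i * (lookup e i * (lower e i !ᵐ * coeff S (lower e i)))
             ≡ K * (c₁ i * (lookup e i * powerProduct c₁ c₂ (lower e i) a))
  term i = begin
    c₁ i * (lookup e i * (lower e i !ᵐ * coeff S (lower e i)))
      ≡⟨ cong (c₁ i *_) (*-cong-positive (lookup e i) λ eᵢ≡1+k →
           polarization c₁ c₂ a b (lower e i) (suc-injective (trans (sym (degree-lower e i eᵢ≡1+k)) ∣e∣≡))) ⟩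
    c₁ i * (lookup e i * (K * powerProduct c₁ c₂ (lower e i) a))
      ≡⟨ cong (c₁ i *_) (x∙yz≈y∙xz (lookup e i) K _) ⟩
    c₁ i * (K * (lookup e i * powerProduct c₁ c₂ (lower e i) a))
      ≡⟨ x∙yz≈y∙xz (c₁ i) K _ ⟩
    K * (c₁ i * (lookup e i * powerProduct c₁ c₂ (lower e i) a))
      ∎

mulLinears : List (ℕ × ℕ) → Coeffs → Coeffs
mulLinears []             X = X
mulLinears ((α , β) ∷ ws) X = mulLinear α β (mulLinears ws X)

mulLinears-cong : ∀ ws {X Y : Coeffs} → X ≗ Y → mulLinears ws X ≗ mulLinears ws Y
mulLinears-cong []             X≗Y = X≗Y
mulLinears-cong ((α , β) ∷ ws) X≗Y = mulLinear-cong α β (mulLinears-cong ws X≗Y)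

mulLinears-++ : ∀ ws vs (X : Coeffs) → mulLinears (ws ++ vs) X ≡ mulLinears ws (mulLinears vs X)
mulLinears-++ []             vs X = refl
mulLinears-++ ((α , β) ∷ ws) vs X = cong (mulLinear α β) (mulLinears-++ ws vs X)

mulLinears-comm : ∀ ws α β (X : Coeffs) → mulLinears ws (mulLinear α β X) ≗ mulLinear α β (mulLinears ws X)
mulLinears-comm []               α β X k = refl
mulLinears-comm ((α′ , β′) ∷ ws) α β X k =
  trans (mulLinear-cong α′ β′ (mulLinears-comm ws α β X) k) (mulLinear-comm α′ β′ α β _ k)

mulPowers-comm : (c₁ c₂ : Fin n → ℕ) (e : Monomial n) (α β : ℕ) (X : Coeffs) →
                 mulLinear α β (mulPowers c₁ c₂ e X) ≗ mulPowers c₁ c₂ e (mulLinear α β X)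
mulPowers-comm c₁ c₂ []      α β X k = refl
mulPowers-comm c₁ c₂ (x ∷ e) α β X k =
  trans (mulLinear^-comm x α β (c₁ zero) (c₂ zero) _ k)
        (mulLinear^-cong (c₁ zero) (c₂ zero) x (mulPowers-comm (c₁ ∘ suc) (c₂ ∘ suc) e α β X) k)

mulPowers-map-suc : (c₁ c₂ : Fin n → ℕ) (e : Monomial n) (X : Coeffs) →
  mulPowers c₁ c₂ (Vec.map suc e) X ≗ mulPowers c₁ c₂ e (mulLinears (tabulate (λ i → c₁ i , c₂ i)) X)
mulPowers-map-suc c₁ c₂ []      X k = refl
mulPowers-map-suc c₁ c₂ (x ∷ e) X k = begin
  mulLinear α β (mulLinear^ α β x (mulPowers c₁′ c₂′ (Vec.map suc e) X)) k
    ≡⟨ mulLinear-cong α β (mulLinear^-cong α β x (mulPowers-map-suc c₁′ c₂′ e X)) k ⟩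
  mulLinear α β (mulLinear^ α β x (mulPowers c₁′ c₂′ e L)) k
    ≡⟨ mulLinear^-comm x α β α β _ k ⟩
  mulLinear^ α β x (mulLinear α β (mulPowers c₁′ c₂′ e L)) k
    ≡⟨ mulLinear^-cong α β x (mulPowers-comm c₁′ c₂′ e α β L) k ⟩
  mulLinear^ α β x (mulPowers c₁′ c₂′ e (mulLinear α β L)) k
    ∎
  where
  open ≡-Reasoning
  α = c₁ zero
  β = c₂ zero
  c₁′ = c₁ ∘ suc
  c₂′ = c₂ ∘ suc
  L = mulLinears (tabulate (λ i → c₁′ i , c₂′ i)) X

DivisibleBetween : ℕ → ℕ → Coeffs → Set
DivisibleBetween lo p X = ∀ k → lo ≤ k → k < p → p ∣ X k

mulLinear-divisibleBetween : ∀ {lo p} α β {X : Coeffs} → DivisibleBetween lo p X →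
                             DivisibleBetween (suc lo) p (mulLinear α β X)
mulLinear-divisibleBetween α β p∣X (suc k) (s≤s lo≤k) 1+k<p =
  ∣m∣n⇒∣m+n (∣-trans (p∣X (suc k) (m≤n⇒m≤1+n lo≤k) 1+k<p) (n∣m*n β))
            (∣-trans (p∣X k lo≤k (<-trans (n<1+n k) 1+k<p)) (n∣m*n α))

mulLinear^-divisibleBetween : ∀ {lo p} α β x {X : Coeffs} → DivisibleBetween lo p X →
                              DivisibleBetween (x + lo) p (mulLinear^ α β x X)
mulLinear^-divisibleBetween α β zero    p∣X = p∣X
mulLinear^-divisibleBetween α β (suc x) p∣X =
  mulLinear-divisibleBetween α β (mulLinear^-divisibleBetween α β x p∣X)

mulPowers-divisibleBetween : ∀ {lo p} (c₁ c₂ : Fin n → ℕ) (e : Monomial n) {X : Coeffs} → DivisibleBetween lo p X →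
                             DivisibleBetween (degree e + lo) p (mulPowers c₁ c₂ e X)
mulPowers-divisibleBetween c₁ c₂ []      p∣X = p∣X
mulPowers-divisibleBetween {lo = lo} {p} c₁ c₂ (x ∷ e) {X} p∣X =
  subst (λ l → DivisibleBetween l p (mulPowers c₁ c₂ (x ∷ e) X)) (sym (+-assoc x (degree e) lo))
        (mulLinear^-divisibleBetween (c₁ zero) (c₂ zero) x
          (mulPowers-divisibleBetween (c₁ ∘ suc) (c₂ ∘ suc) e p∣X))

-- The Taylor shift and the Stirling congruence

∑< : ℕ → (ℕ → ℕ) → ℕ
∑< N g = ∑[ j < N ] g (toℕ j)

∑<-cong : ∀ N {g h : ℕ → ℕ} → (∀ j → j < N → g j ≡ h j) → ∑< N g ≡ ∑< N h
∑<-cong N g≡h = sum-cong-≗ {N} λ j → g≡h (toℕ j) (toℕ<n j)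

∑<-+ : ∀ N (g h : ℕ → ℕ) → ∑< N (λ j → g j + h j) ≡ ∑< N g + ∑< N h
∑<-+ N g h = ∑-distrib-+ {N} (g ∘ toℕ) (h ∘ toℕ)

∑<-*ˡ : ∀ N c (g : ℕ → ℕ) → ∑< N (λ j → c * g j) ≡ c * ∑< N g
∑<-*ˡ N c g = sym (*-distribˡ-sum {N} c (g ∘ toℕ))

∑<-suc : ∀ N (g : ℕ → ℕ) → ∑< (suc N) g ≡ ∑< N g + g N
∑<-suc zero    g = +-comm (g 0) 0
∑<-suc (suc N) g = trans (cong (g 0 +_) (∑<-suc N (g ∘ suc))) (sym (+-assoc (g 0) _ _))

∑<-split : ∀ a b (g : ℕ → ℕ) → ∑< (a + b) g ≡ ∑< a g + ∑< b (λ j → g (j + a))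
∑<-split zero    b g = ∑<-cong b λ j _ → cong g (sym (+-identityʳ j))
∑<-split (suc a) b g = begin
  g 0 + ∑< (a + b) (g ∘ suc)
    ≡⟨ cong (g 0 +_) (∑<-split a b (g ∘ suc)) ⟩
  g 0 + (∑< a (g ∘ suc) + ∑< b (λ j → g (suc (j + a))))
    ≡⟨ +-assoc (g 0) _ _ ⟨
  (g 0 + ∑< a (g ∘ suc)) + ∑< b (λ j → g (suc (j + a)))
    ≡⟨ cong (_ +_) (∑<-cong b λ j _ → cong g (sym (+-suc j a))) ⟩
  (g 0 + ∑< a (g ∘ suc)) + ∑< b (λ j → g (j + suc a))
    ∎
  where open ≡-Reasoning

∑<-divisible : ∀ {d} N (g : ℕ → ℕ) → (∀ j → j < N → d ∣ g j) → d ∣ ∑< N g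
∑<-divisible zero    g d∣g = _ ∣0
∑<-divisible (suc N) g d∣g = ∣m∣n⇒∣m+n (d∣g 0 z<s) (∑<-divisible N (g ∘ suc) λ j j<N → d∣g (suc j) (s≤s j<N))

DegreeBelow : ℕ → Coeffs → Set
DegreeBelow N X = ∀ j → N ≤ j → X j ≡ 0

mulLinear-degreeBelow : ∀ {N} α β {X : Coeffs} → DegreeBelow N X → DegreeBelow (suc N) (mulLinear α β X)
mulLinear-degreeBelow α β X<N (suc j) (s≤s N≤j)
  rewrite X<N (suc j) (m≤n⇒m≤1+n N≤j) | X<N j N≤j = cong₂ _+_ (*-zeroʳ β) (*-zeroʳ α)

-- The coefficients of X (t + 1), for X of degree below N.
taylorShift : ℕ → Coeffs → Coeffs
taylorShift N X m = ∑< N (λ j → (j C m) * X j)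

mulT : Coeffs → Coeffs
mulT X zero    = 0
mulT X (suc j) = X j

mulLinear-1 : ∀ β (X : Coeffs) j → mulLinear 1 β X j ≡ β * X j + mulT X j
mulLinear-1 β X zero    = sym (+-identityʳ _)
mulLinear-1 β X (suc j) = cong (β * X (suc j) +_) (*-identityˡ (X j))

taylorShift-mulT : ∀ N (X : Coeffs) → taylorShift (suc N) (mulT X) ≗ mulLinear 1 1 (taylorShift N X)
taylorShift-mulT N X m = trans (cong (_+ ∑< N (λ j → (suc j C m) * X j)) (*-zeroʳ (0 C m))) (pascal m)
  where
  T = taylorShift N X
  pascal : ∀ m → ∑< N (λ j → (suc j C m) * X j) ≡ mulLinear 1 1 T m
  pascal zero    = sym (*-identityˡ (T 0))
  pascal (suc m) = begin
    ∑< N (λ j → (suc j C suc m) * X j)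
      ≡⟨ ∑<-cong N (λ j _ → trans (cong (_* X j) (sym (nCk+nC[k+1]≡[n+1]C[k+1] j m)))
                                  (*-distribʳ-+ (X j) (j C m) _)) ⟩
    ∑< N (λ j → (j C m) * X j + (j C suc m) * X j)
      ≡⟨ ∑<-+ N (λ j → (j C m) * X j) (λ j → (j C suc m) * X j) ⟩
    T m + T (suc m)
      ≡⟨ regroup (T m) (T (suc m)) ⟩
    1 * T (suc m) + 1 * T m
      ∎
    where
    open ≡-Reasoning
    regroup : ∀ a b → a + b ≡ 1 * b + 1 * a
    regroup = solve-∀

taylorShift-mulLinear : ∀ N β (X : Coeffs) → DegreeBelow N X →
  taylorShift (suc N) (mulLinear 1 β X) ≗ mulLinear 1 (suc β) (taylorShift N X)
taylorShift-mulLinear N β X X<N m = begin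
  ∑< (suc N) (λ j → (j C m) * mulLinear 1 β X j)
    ≡⟨ ∑<-cong (suc N) (λ j _ → trans (cong ((j C m) *_) (mulLinear-1 β X j)) (distrib (j C m) β (X j) _)) ⟩
  ∑< (suc N) (λ j → β * ((j C m) * X j) + (j C m) * mulT X j)
    ≡⟨ ∑<-+ (suc N) (λ j → β * ((j C m) * X j)) (λ j → (j C m) * mulT X j) ⟩
  ∑< (suc N) (λ j → β * ((j C m) * X j)) + taylorShift (suc N) (mulT X) m
    ≡⟨ cong₂ _+_ (trans (∑<-*ˡ (suc N) β (λ j → (j C m) * X j)) (cong (β *_) top-vanishes))
                 (taylorShift-mulT N X m) ⟩
  β * (T m + 0) + mulLinear 1 1 T m
    ≡⟨ regroup m ⟩
  mulLinear 1 (suc β) T m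
    ∎
  where
  open ≡-Reasoning
  T = taylorShift N X
  top-vanishes : taylorShift (suc N) X m ≡ T m + 0
  top-vanishes = trans (∑<-suc N (λ j → (j C m) * X j))
                       (cong (T m +_) (trans (cong ((N C m) *_) (X<N N ≤-refl)) (*-zeroʳ (N C m))))
  distrib : ∀ c β x y → c * (β * x + y) ≡ β * (c * x) + c * y
  distrib = solve-∀
  regroup : ∀ m → β * (T m + 0) + mulLinear 1 1 T m ≡ mulLinear 1 (suc β) T m
  regroup zero    = ring β (T 0)
    where
    ring : ∀ β t → β * (t + 0) + 1 * t ≡ suc β * t
    ring = solve-∀
  regroup (suc m) = ring β (T m) (T (suc m))
    where
    ring : ∀ β a b → β * (b + 0) + (1 * b + 1 * a) ≡ suc β * b + 1 * a
    ring = solve-∀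

rising : List ℕ → Coeffs
rising js = mulLinears (map (1 ,_) js) (δ 0)

rising-degreeBelow : ∀ js → DegreeBelow (suc (length js)) (rising js)
rising-degreeBelow []       (suc j) _ = refl
rising-degreeBelow (j ∷ js) = mulLinear-degreeBelow 1 j (rising-degreeBelow js)

taylorShift-rising : ∀ js → taylorShift (suc (length js)) (rising js) ≗ rising (map suc js)
taylorShift-rising []       zero    = refl
taylorShift-rising []       (suc m) = refl
taylorShift-rising (j ∷ js) m =
  trans (taylorShift-mulLinear (suc (length js)) j (rising js) (rising-degreeBelow js) m)
        (mulLinear-cong 1 (suc j) (taylorShift-rising js) m)

rising-∷ʳ : ∀ js j → rising (js ∷ʳ j) ≗ mulLinear 1 j (rising js)
rising-∷ʳ js j k = begin
  mulLinears (map (1 ,_) (js ++ j ∷ [])) (δ 0) k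
    ≡⟨ cong (λ ws → mulLinears ws (δ 0) k) (Listₚ.map-++ (1 ,_) js (j ∷ [])) ⟩
  mulLinears (map (1 ,_) js ++ (1 , j) ∷ []) (δ 0) k
    ≡⟨ cong (λ Y → Y k) (mulLinears-++ (map (1 ,_) js) _ (δ 0)) ⟩
  mulLinears (map (1 ,_) js) (mulLinear 1 j (δ 0)) k
    ≡⟨ mulLinears-comm (map (1 ,_) js) 1 j (δ 0) k ⟩
  mulLinear 1 j (rising js) k
    ∎
  where open ≡-Reasoning

∣*∤⇒∣ : ∀ {p m n} → Prime p → p ∣ m * n → ¬ p ∣ m → p ∣ n
∣*∤⇒∣ {m = m} {n} pr p∣m*n p∤m with euclidsLemma m n pr p∣m*n
... | inj₁ p∣m = ⊥-elim (p∤m p∣m)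
... | inj₂ p∣n = p∣n

prime∤1 : ∀ {p} → Prime p → ¬ p ∣ 1
prime∤1 pr p∣1 = ¬prime[1] (subst Prime (∣1⇒≡1 p∣1) pr)

prime∤! : ∀ {p} → Prime p → ∀ {k} → k < p → ¬ p ∣ k !
prime∤! pr {zero}  _   = prime∤1 pr
prime∤! pr {suc k} k<p p∣k! with euclidsLemma (suc k) (k !) pr p∣k!
... | inj₁ p∣1+k = >⇒∤ k<p p∣1+k
... | inj₂ p∣k!′ = prime∤! pr (<-trans (n<1+n k) k<p) p∣k!′

prime∣C : ∀ {p m} → Prime p → 0 < m → m < p → p ∣ p C m
prime∣C {suc q} {suc m} pr _ m<p with euclidsLemma (suc q C suc m) D pr p∣C*D
  where
  D = suc m ! * (q ∸ m) !
  p∣C*D : suc q ∣ (suc q C suc m) * D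
  p∣C*D = subst (suc q ∣_) (sym C*D≡p!) (m∣m*n (q !))
    where
    C*D≡p! : (suc q C suc m) * D ≡ suc q !
    C*D≡p! = trans (cong (_* D) (nCk≡n!/k![n-k]! (<⇒≤ m<p)))
                   (m/n*n≡m {{suc m !* (q ∸ m) !≢0}} (k![n∸k]!∣n! (<⇒≤ m<p)))
... | inj₁ p∣C   = p∣C
... | inj₂ p∣D with euclidsLemma (suc m !) ((q ∸ m) !) pr p∣D
...   | inj₁ p∣m! = ⊥-elim (prime∤! pr m<p p∣m!)
...   | inj₂ p∣r! = ⊥-elim (prime∤! pr (s≤s (m∸n≤m q m)) p∣r!)

prime∤!ᵐ : ∀ {p} → Prime p → (e : Monomial n) → (∀ i → lookup e i < p) → ¬ p ∣ e !ᵐ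
prime∤!ᵐ pr []      _   = prime∤1 pr
prime∤!ᵐ pr (x ∷ e) e<p p∣ with euclidsLemma (x !) (e !ᵐ) pr p∣
... | inj₁ p∣x! = prime∤! pr (e<p zero) p∣x!
... | inj₂ p∣e! = prime∤!ᵐ pr e (e<p ∘ suc) p∣e!

module _ {q : ℕ} where

  private
    p : ℕ
    p = suc q

    -- R = (t + 1) ⋯ (t + q) and Q = t R = t (t + 1) ⋯ (t + q)
    R Q : Coeffs
    R = rising (applyUpTo suc q)
    Q = rising (upTo p)

  rising-suc : ∀ m → rising (applyUpTo suc p) m ≡ p * R m + Q m
  rising-suc m = trans (cong (λ js → rising js m) (sym (Listₚ.applyUpTo-∷ʳ suc q)))
                       (trans (rising-∷ʳ (applyUpTo suc q) p m) (split m))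
    where
    split : ∀ m → mulLinear 1 p R m ≡ p * R m + Q m
    split zero    = sym (+-identityʳ _)
    split (suc m) = refl

  -- Q (t + 1) = (t + p) R, which is Q + p R.
  taylorShift-Q : ∀ m → taylorShift (suc p) Q m ≡ p * R m + Q m
  taylorShift-Q m = begin
    taylorShift (suc p) Q m
      ≡⟨ subst (λ L → taylorShift (suc L) Q m ≡ rising (map suc (upTo p)) m) (Listₚ.length-upTo p)
               (taylorShift-rising (upTo p) m) ⟩
    rising (map suc (upTo p)) m
      ≡⟨ cong (λ js → rising js m) (Listₚ.map-upTo suc p) ⟩
    rising (applyUpTo suc p) m
      ≡⟨ rising-suc m ⟩
    p * R m + Q m
      ∎
    where open ≡-Reasoning

  private
    -- Σ_{m + 2 ≤ j ≤ p} (j C m) Q j, when p = m + 2 + o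
    upperTail : ℕ → ℕ → ℕ
    upperTail m o = ∑< (suc o) (λ j → (suc (suc (j + m)) C m) * Q (suc (suc (j + m))))

  taylorShift-Q-expansion : ∀ m o → suc (suc m) + o ≡ p →
                            taylorShift (suc p) Q m ≡ Q m + (suc m * Q (suc m) + upperTail m o)
  taylorShift-Q-expansion m o 2+m+o≡p = begin
    ∑< (suc p) g
      ≡⟨ cong (λ N → ∑< N g) (sym (trans (regroup m o) (cong suc 2+m+o≡p))) ⟩
    ∑< (m + suc (suc (suc o))) g
      ≡⟨ ∑<-split m _ g ⟩
    ∑< m g + (g m + (g (suc m) + upperTail m o))
      ≡⟨ cong₂ (λ a b → a + (b + (g (suc m) + upperTail m o))) below diagonal ⟩
    Q m + (g (suc m) + upperTail m o)
      ≡⟨ cong (λ z → Q m + (z + upperTail m o)) next ⟩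
    Q m + (suc m * Q (suc m) + upperTail m o)
      ∎
    where
    open ≡-Reasoning
    g : ℕ → ℕ
    g j = (j C m) * Q j
    regroup : ∀ m o → m + suc (suc (suc o)) ≡ suc (suc (suc (m + o)))
    regroup = solve-∀
    below : ∑< m g ≡ 0
    below = trans (∑<-cong m λ j j<m → cong (_* Q j) (k>n⇒nCk≡0 j<m)) (∑-zero {m} λ _ → refl)
    diagonal : g m ≡ Q m
    diagonal = trans (cong (_* Q m) (nCn≡1 m)) (+-identityʳ (Q m))
    next : g (suc m) ≡ suc m * Q (suc m)
    next = cong (_* Q (suc m))
                (trans (nCk≡nC[n∸k] (n≤1+n m)) (trans (cong (suc m C_) (m+n∸n≡m 1 m)) (nC1≡n (suc m))))

  module _ (pr : Prime p) where

    upperTail-divisible : ∀ m o → 0 < m → suc (suc m) + o ≡ p →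
                          (∀ j → suc m < j → j < p → p ∣ Q j) → p ∣ upperTail m o
    upperTail-divisible m o 0<m 2+m+o≡p p∣Q-above = ∑<-divisible (suc o) _ λ j j<1+o → term j (J≤p j j<1+o)
      where
      J≤p : ∀ j → j < suc o → suc (suc (j + m)) ≤ p
      J≤p j (s≤s j≤o) = subst (suc (suc (j + m)) ≤_) (trans (cong (λ x → suc (suc x)) (+-comm o m)) 2+m+o≡p)
                              (s≤s (s≤s (+-monoˡ-≤ m j≤o)))
      term : ∀ j → suc (suc (j + m)) ≤ p → p ∣ (suc (suc (j + m)) C m) * Q (suc (suc (j + m)))
      term j J≤p with m≤n⇒m<n∨m≡n J≤p
      ... | inj₁ J<p  = ∣-trans (p∣Q-above _ (s≤s (s≤s (m≤n+m m j))) J<p) (n∣m*n (suc (suc (j + m)) C m))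
      ... | inj₂ refl = ∣-trans (prime∣C pr 0<m (s≤s (m≤n⇒m≤1+n (m≤n+m m j)))) (m∣m*n (Q p))

    -- Degree m of taylorShift-Q: Q_m + (m+1) Q_{m+1} + (terms divisible by p) = Q_m + p R_m.
    Q-step : ∀ m → 0 < m → suc m < p → (∀ j → suc m < j → j < p → p ∣ Q j) → p ∣ Q (suc m)
    Q-step m 0<m 1+m<p p∣Q-above with m≤n⇒∃[o]m+o≡n 1+m<p
    ... | o , 2+m+o≡p = ∣*∤⇒∣ pr p∣next (>⇒∤ 1+m<p)
      where
      p∣next+tail : p ∣ suc m * Q (suc m) + upperTail m o
      p∣next+tail = subst (p ∣_)
        (+-cancelˡ-≡ (Q m) _ _ (trans (+-comm (Q m) (p * R m))
                                      (trans (sym (taylorShift-Q m)) (taylorShift-Q-expansion m o 2+m+o≡p))))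
        (m∣m*n (R m))
      p∣next : p ∣ suc m * Q (suc m)
      p∣next = ∣m+n∣m⇒∣n (subst (p ∣_) (+-comm _ (upperTail m o)) p∣next+tail)
                         (upperTail-divisible m o 0<m 2+m+o≡p p∣Q-above)

    Q-divisible : ∀ k → 2 ≤ k → k < p → p ∣ Q k
    Q-divisible k 2≤k k<p = within-gap p k 2≤k k<p (m≤n+m p k)
      where
      within-gap : ∀ d k → 2 ≤ k → k < p → p ≤ k + d → p ∣ Q k
      within-gap zero    k       _         k<p p≤k+0 = ⊥-elim (<⇒≱ k<p (subst (p ≤_) (+-identityʳ k) p≤k+0))
      within-gap (suc d) (suc m) (s≤s 0<m) k<p p≤k+d = Q-step m 0<m k<p λ j 1+m<j j<p →
        within-gap d j (≤-trans (s≤s 0<m) (<⇒≤ 1+m<j)) j<p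
          (≤-trans p≤k+d (≤-trans (≤-reflexive (+-suc (suc m) d)) (+-monoˡ-≤ d 1+m<j)))

    stirling : DivisibleBetween 2 p (rising (applyUpTo suc p))
    stirling k 2≤k k<p = subst (p ∣_) (sym (rising-suc k)) (∣m∣n⇒∣m+n (m∣m*n (R k)) (Q-divisible k 2≤k k<p))

-- The polynomial f

tabulate-toℕ : (h : ℕ → A) → tabulate {n = n} (h ∘ toℕ) ≡ applyUpTo h n
tabulate-toℕ {n = zero}  h = refl
tabulate-toℕ {n = suc n} h = cong (h 0 ∷_) (tabulate-toℕ (h ∘ suc))

applyUpTo-cong : ∀ n {f g : ℕ → A} → (∀ j → j < n → f j ≡ g j) → applyUpTo f n ≡ applyUpTo g n
applyUpTo-cong zero    f≡g = refl
applyUpTo-cong (suc n) f≡g = cong₂ _∷_ (f≡g 0 z<s) (applyUpTo-cong n λ j j<n → f≡g (suc j) (s≤s j<n))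

<ᵇ-irrefl : ∀ n → (n <ᵇ n) ≡ false
<ᵇ-irrefl zero    = refl
<ᵇ-irrefl (suc n) = <ᵇ-irrefl n

-- L1 p and L2 p are definitionally linear (ℓ₁ p) and linear (ℓ₂ p).
ℓ₁ ℓ₂ : (p : ℕ) → Fin (suc p) → ℕ
ℓ₁ p i = if toℕ i <ᵇ p then 1 else 0
ℓ₂ p i = if toℕ i <ᵇ p then suc (toℕ i) else 1

-- The last variable contributes the factor 0 t + 1.
linear-factors : ∀ p → mulLinears (tabulate (λ i → ℓ₁ p i , ℓ₂ p i)) (δ 0) ≗ rising (applyUpTo suc p)
linear-factors p k = begin
  mulLinears (tabulate {n = suc p} (h ∘ toℕ)) (δ 0) k
    ≡⟨ cong (λ ws → mulLinears ws (δ 0) k) (trans (tabulate-toℕ h) (sym (Listₚ.applyUpTo-∷ʳ h p))) ⟩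
  mulLinears (applyUpTo h p ++ h p ∷ []) (δ 0) k
    ≡⟨ cong (λ ws → mulLinears (ws ++ h p ∷ []) (δ 0) k) below-p ⟩
  mulLinears (map (1 ,_) (applyUpTo suc p) ++ h p ∷ []) (δ 0) k
    ≡⟨ cong (λ Y → Y k) (mulLinears-++ (map (1 ,_) (applyUpTo suc p)) _ (δ 0)) ⟩
  mulLinears (map (1 ,_) (applyUpTo suc p)) (mulLinear (proj₁ (h p)) (proj₂ (h p)) (δ 0)) k
    ≡⟨ mulLinears-cong (map (1 ,_) (applyUpTo suc p)) top k ⟩
  rising (applyUpTo suc p) k
    ∎
  where
  open ≡-Reasoning
  h : ℕ → ℕ × ℕ
  h j = (if j <ᵇ p then 1 else 0) , (if j <ᵇ p then suc j else 1)
  below-p : applyUpTo h p ≡ map (1 ,_) (applyUpTo suc p)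
  below-p = trans (applyUpTo-cong p λ j j<p → cong (λ b → (if b then 1 else 0) , (if b then suc j else 1))
                                                   (Equivalence.to T-≡ (<⇒<ᵇ j<p)))
                  (sym (Listₚ.map-applyUpTo suc (1 ,_) p))
  top : mulLinear (proj₁ (h p)) (proj₂ (h p)) (δ 0) ≗ δ 0
  top rewrite <ᵇ-irrefl p = λ { zero → refl ; (suc k) → refl }

powerProduct-divisible : ∀ {q} → Prime (suc q) → (e : Monomial (suc (suc q))) → (∀ i → 1 ≤ lookup e i) →
                         degree e ≡ q + q → suc q ∣ powerProduct (ℓ₁ (suc q)) (ℓ₂ (suc q)) e q
powerProduct-divisible {q} pr e e≥1 ∣e∣≡2q =
  subst (λ e → p ∣ powerProduct c₁ c₂ e q) (map-suc-pred e e≥1)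
    (subst (p ∣_) (sym (mulPowers-map-suc c₁ c₂ e′ (δ 0) q))
      (mulPowers-divisibleBetween c₁ c₂ e′ factors-divisible q (≤-reflexive ∣e′∣+2≡q) ≤-refl))
  where
  p = suc q
  c₁ = ℓ₁ p
  c₂ = ℓ₂ p
  e′ = Vec.map pred e
  factors-divisible : DivisibleBetween 2 p (mulLinears (tabulate (λ i → c₁ i , c₂ i)) (δ 0))
  factors-divisible k 2≤k k<p = subst (p ∣_) (sym (linear-factors p k)) (stirling pr k 2≤k k<p)
  ∣e′∣+2≡q : degree e′ + 2 ≡ q
  ∣e′∣+2≡q = +-cancelʳ-≡ q _ _ (begin
    (degree e′ + 2) + q     ≡⟨ regroup (degree e′) q ⟩
    degree e′ + suc p       ≡⟨ degree-map-suc e′ ⟨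
    degree (Vec.map suc e′) ≡⟨ cong degree (map-suc-pred e e≥1) ⟩
    degree e                ≡⟨ ∣e∣≡2q ⟩
    q + q                   ∎)
    where
    open ≡-Reasoning
    regroup : ∀ d q → (d + 2) + q ≡ d + suc (suc q)
    regroup = solve-∀

exponents<p : ∀ {q} (e : Monomial (suc (suc q))) → (∀ i → 1 ≤ lookup e i) → degree e ≡ q + q →
              ∀ i → lookup e i < suc q
exponents<p {q} e e≥1 ∣e∣≡2q i =
  m<n⇒m<1+n (+-cancelʳ-< q (lookup e i) q
    (subst (_≤ q + q) (+-suc (lookup e i) q)
           (subst (lookup e i + suc q ≤_) ∣e∣≡2q (lookup+n≤degree e e≥1 i))))

lemma5 : (p : ℕ) → Prime p → p ≢ 2 → (e : Vec ℕ (suc p)) → (∀ (i : Fin (suc p)) → 1 ≤ lookup e i) → p ∣ coeff (f p) e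
lemma5 zero       pr _ _ _ = ⊥-elim (¬prime[0] pr)
lemma5 (suc zero) pr _ _ _ = ⊥-elim (¬prime[1] pr)
lemma5 (suc q)    pr _ e e≥1 with degree e ≟ q + q
... | no ∣e∣≢2q =
  subst (suc q ∣_) (sym (^P-*P-homogeneous (ℓ₁ (suc q)) q (^P-homogeneous (ℓ₂ (suc q)) q) e ∣e∣≢2q))
        (suc q ∣0)
... | yes ∣e∣≡2q = ∣*∤⇒∣ pr p∣e!*coeff (prime∤!ᵐ pr e (exponents<p e e≥1 ∣e∣≡2q))
  where
  p∣e!*coeff : suc q ∣ e !ᵐ * coeff (f (suc q)) e
  p∣e!*coeff = subst (suc q ∣_) (sym (polarization (ℓ₁ (suc q)) (ℓ₂ (suc q)) q q e ∣e∣≡2q))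
                     (∣-trans (powerProduct-divisible pr e e≥1 ∣e∣≡2q) (n∣m*n (q ! * q !)))
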